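{- Let $k\ge 1$ and $0\le t\le k$ be integers and let $n\ge 1$. The total number of down-steps before the first up-step, summed over all $k_t$-Dyck paths of length $(k+1)n$, is \[ s_{n,t,0}=\frac{k}{n+1}\binom{(k+1)n}{n}-\frac{k-t}{n+1}\binom{(k+1)n+t}{n}. \]
   Context: A $k_t$-Dyck path (for a positive integer $k$ and integer $0\le t\le k$) is a lattice path consisting of up-steps $(1,k)$ and down-steps $(1,-1)$ that starts at $(0,0)$, stays weakly above the line $y=-t$, and ends on the line $y=0$; with $n$ up-steps it has length $(k+1)n$. $s_{n,t,0}$ denotes the total number, over all $k_t$-Dyck paths with $n$ up-steps, of down-steps occurring before the first up-step. -}

module Defs where

open import Data.Nat using (ℕ; zero; suc; _+_; _*_; _∸_)
open import Data.Bool using (Bool; true; false; _∧_)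
open import Data.List using (List; []; _∷_; map; _++_; filter; length)
open import Data.Nat.ListAction using (sum)
open import Data.Nat using (_≡ᵇ_)

-- A step of a lattice path: U = up-step (1,k), D = down-step (1,-1).
data Step : Set where
  U D : Step

words : ℕ → List (List Step)
words zero    = [] ∷ []
words (suc m) = map (U ∷_) (words m) ++ map (D ∷_) (words m)

-- stays k t h w : walking w from (shifted) height h, where the shifted height
-- is y + t, the path never goes below y = -t (shifted height 0) and ends at
-- y = 0 (shifted height t).
stays : ℕ → ℕ → ℕ → List Step → Bool
stays k t h []           = h ≡ᵇ t
stays k t h (U ∷ w)      = stays k t (h + k) w
stays k t zero (D ∷ w)   = false
stays k t (suc h) (D ∷ w) = stays k t h w

ups : List Step → ℕ
ups []      = 0
ups (U ∷ w) = suc (ups w)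
ups (D ∷ w) = ups w

isDyck : ℕ → ℕ → ℕ → List Step → Bool
isDyck k t n w = stays k t t w ∧ (ups w ≡ᵇ n)

dyckPaths : ℕ → ℕ → ℕ → List (List Step)
dyckPaths k t n = filter (λ w → Data.Bool._≟_ (isDyck k t n w) true) (words ((k + 1) * n))

leadingDowns : List Step → ℕ
leadingDowns []      = 0
leadingDowns (U ∷ w) = 0
leadingDowns (D ∷ w) = suc (leadingDowns w)

s0 : ℕ → ℕ → ℕ → ℕ
s0 k n t = sum (map leadingDowns (dyckPaths k t n))

module Submission where

-- Proof strategy.  Shift heights by t, so that a k_t-Dyck path is a word in
-- {U, D} that starts at height t, never goes below 0 and ends at t.
--
-- 1. Leading down-steps.  Counting, for each height h < t, the paths whose
--    leading run of down-steps passes from h+1 to h gives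
--      s_{n,t,0} = Σ_{h<t} P(n, h),
--    where P(n, h) is the number of paths from height h to height 0 with n
--    up-steps (ending at t is ending at 0 after t further down-steps).
-- 2. Ballot theorem.  Along the first-step recursion one shows
--      P(n, h) + k·C(N, n-1) = C(N, n),   N = h + (k+1)n,
--    using Pascal's rule and the absorption identity for binomials.
-- 3. Telescoping.  With absorption once more, (n+1)·P(n, t) is the
--    difference of consecutive terms (k-t)·C(t + (k+1)n, n), so
--      (n+1)·s_{n,t,0} + (k-t)·C((k+1)n + t, n) = k·C((k+1)n, n)
--    in ℕ, and dividing by n+1 in ℚ gives the theorem.

open import Data.Bool using (Bool; true; false; T; _∧_)
import Data.Bool as Bool
open import Data.Empty using (⊥-elim)
open import Data.List using (List; []; _∷_; map; _++_; filter; length)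
open import Data.List.Properties using (map-++; map-∘)
open import Data.Nat using (ℕ; zero; suc; _+_; _*_; _∸_; _≤_; _<_; s≤s; z≤n; _≡ᵇ_)
open import Data.Nat.Properties
  using ( +-identityʳ; *-identityʳ; *-zeroʳ; *-suc; +-suc; +-comm; +-assoc
        ; +-cancelˡ-≡; +-cancelʳ-≡; *-cancelˡ-≡; +-∸-assoc; m+[n∸m]≡n; m∸n+n≡m
        ; ≤-trans; <⇒≤; n<1+n; n≤1+n; m≤n⇒m≤1+n; m≤m+n; m≤n+m; m≤m*n
        ; ≡ᵇ⇒≡; ≡⇒≡ᵇ )
open import Data.Nat.Combinatorics using (_C_; nC1≡n; k>n⇒nCk≡0; nCk+nC[k+1]≡[n+1]C[k+1])
open import Data.Nat.ListAction using (sum)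
open import Data.Nat.ListAction.Properties using (sum-++)
open import Data.Nat.Tactic.RingSolver using (solve-∀)
open import Data.Unit using (tt)
open import Function using (_∘_)
open import Relation.Binary.PropositionalEquality
open import Defs

module ClearingDenominators where
  open import Data.Integer as ℤ using (ℤ; +_)
  open import Data.Integer.Properties using (pos-+; pos-*)
  import Data.Integer.Tactic.RingSolver as ℤ-Solver
  open import Data.Rational as ℚ using (_/_; toℚᵘ) renaming (_-_ to _-ℚ_; _*_ to _*ℚ_)
  open import Data.Rational.Properties using (toℚᵘ-injective; toℚᵘ-fromℚᵘ; toℚᵘ-homo-*; toℚᵘ-homo-+; toℚᵘ-homo‿-)
  open import Data.Rational.Unnormalised as ℚᵘ using (mkℚᵘ; *≡*; _≃_)
  import Data.Rational.Unnormalised.Properties as ℚᵘP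

  toℚᵘ-/ : ∀ (i : ℤ) n → toℚᵘ (i / suc n) ≃ mkℚᵘ i n
  toℚᵘ-/ i n = toℚᵘ-fromℚᵘ (mkℚᵘ i n)

  rational-form : ∀ s k c d e n → suc n * s + d * e ≡ k * c →
    (+ s) / 1 ≡ (((+ k) / suc n) *ℚ ((+ c) / 1)) -ℚ (((+ d) / suc n) *ℚ ((+ e) / 1))
  rational-form s k c d e n eq = toℚᵘ-injective (begin
    toℚᵘ ((+ s) / 1)                                                      ≈⟨ toℚᵘ-/ (+ s) 0 ⟩
    mkℚᵘ (+ s) 0                                                          ≈⟨ *≡* cross ⟩
    mkℚᵘ (+ k) n ℚᵘ.* mkℚᵘ (+ c) 0 ℚᵘ.- mkℚᵘ (+ d) n ℚᵘ.* mkℚᵘ (+ e) 0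
      ≈⟨ ℚᵘP.+-cong (ℚᵘP.*-cong (ℚᵘP.≃-sym (toℚᵘ-/ (+ k) n)) (ℚᵘP.≃-sym (toℚᵘ-/ (+ c) 0)))
                (ℚᵘP.-‿cong (ℚᵘP.*-cong (ℚᵘP.≃-sym (toℚᵘ-/ (+ d) n)) (ℚᵘP.≃-sym (toℚᵘ-/ (+ e) 0)))) ⟩
    toℚᵘ k/n+1 ℚᵘ.* toℚᵘ c/1 ℚᵘ.- toℚᵘ d/n+1 ℚᵘ.* toℚᵘ e/1
      ≈⟨ ℚᵘP.+-cong (ℚᵘP.≃-sym (toℚᵘ-homo-* k/n+1 c/1)) (ℚᵘP.-‿cong (ℚᵘP.≃-sym (toℚᵘ-homo-* d/n+1 e/1))) ⟩
    toℚᵘ P ℚᵘ.- toℚᵘ Q                                                    ≈⟨ ℚᵘP.+-cong (ℚᵘP.≃-refl {toℚᵘ P}) (ℚᵘP.≃-sym (toℚᵘ-homo‿- Q)) ⟩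
    toℚᵘ P ℚᵘ.+ toℚᵘ (ℚ.- Q)                                              ≈⟨ ℚᵘP.≃-sym (toℚᵘ-homo-+ P (ℚ.- Q)) ⟩
    toℚᵘ (P -ℚ Q)                                                         ∎)
    where
    open ℚᵘP.≃-Reasoning
    k/n+1 = (+ k) / suc n
    d/n+1 = (+ d) / suc n
    c/1 = (+ c) / 1
    e/1 = (+ e) / 1
    P = k/n+1 *ℚ c/1
    Q = d/n+1 *ℚ e/1
    -- both products on the right have denominator (n+1)·1
    X = + (suc n * 1)
    eqℕ : suc n * 1 * s + d * e ≡ k * c
    eqℕ = trans (cong (λ m → m * s + d * e) (*-identityʳ (suc n))) eq
    eqℤ : X ℤ.* + s ℤ.+ + d ℤ.* + e ≡ + k ℤ.* + c
    eqℤ = trans (cong₂ ℤ._+_ (sym (pos-* (suc n * 1) s)) (sym (pos-* d e)))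
                (trans (sym (pos-+ (suc n * 1 * s) (d * e))) (trans (cong +_ eqℕ) (pos-* k c)))
    expand : ∀ (S D E X : ℤ) → S ℤ.* (X ℤ.* X) ≡ ((X ℤ.* S ℤ.+ D ℤ.* E) ℤ.* X ℤ.+ ℤ.- (D ℤ.* E) ℤ.* X) ℤ.* ℤ.1ℤ
    expand = ℤ-Solver.solve-∀
    cross : + s ℤ.* (X ℤ.* X) ≡ (+ k ℤ.* + c ℤ.* X ℤ.+ ℤ.- (+ d ℤ.* + e) ℤ.* X) ℤ.* ℤ.1ℤ
    cross = trans (expand (+ s) (+ d) (+ e) X) (cong (λ z → (z ℤ.* X ℤ.+ ℤ.- (+ d ℤ.* + e) ℤ.* X) ℤ.* ℤ.1ℤ) eqℤ)

open ClearingDenominators using (rational-form)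

open ≡-Reasoning

absorption : ∀ j e → suc j * ((j + e) C suc j) ≡ e * ((j + e) C j)
absorption zero e = trans (+-identityʳ (e C 1)) (trans (nC1≡n e) (sym (*-identityʳ e)))
absorption (suc j) zero rewrite +-identityʳ j | k>n⇒nCk≡0 (n<1+n (suc j)) = *-zeroʳ (suc (suc j))
absorption (suc j) (suc e) rewrite +-suc j e = begin
  suc (suc j) * (suc N C suc (suc j))
    ≡⟨ cong (suc (suc j) *_) (sym (nCk+nC[k+1]≡[n+1]C[k+1] N (suc j))) ⟩
  suc (suc j) * (b + c)                  ≡⟨ split j b c ⟩
  suc j * b + b + suc (suc j) * c        ≡⟨ cong₂ (λ x y → x + b + y) absorb-j (absorption (suc j) e) ⟩
  suc e * a + b + e * b                  ≡⟨ merge e a b ⟩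
  suc e * (a + b)                        ≡⟨ cong (suc e *_) (nCk+nC[k+1]≡[n+1]C[k+1] N j) ⟩
  suc e * (suc N C suc j)                ∎
  where
  N = suc (j + e)
  a = N C j
  b = N C suc j
  c = N C suc (suc j)
  absorb-j : suc j * b ≡ suc e * a
  absorb-j = subst (λ M → suc j * (M C suc j) ≡ suc e * (M C j)) (+-suc j e) (absorption j (suc e))
  split : ∀ j b c → suc (suc j) * (b + c) ≡ suc j * b + b + suc (suc j) * c
  split = solve-∀
  merge : ∀ e a b → suc e * a + b + e * b ≡ suc e * (a + b)
  merge = solve-∀

binomBelow : ℕ → ℕ → ℕ
binomBelow N zero    = 0
binomBelow N (suc n) = N C n

binomBelow-pascal : ∀ N n → binomBelow N n + binomBelow N (suc n) ≡ binomBelow (suc N) (suc n)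
binomBelow-pascal N zero    = refl
binomBelow-pascal N (suc n) = nCk+nC[k+1]≡[n+1]C[k+1] N n

ind : Bool → ℕ
ind true  = 1
ind false = 0

ind-∧ : ∀ b c → (T b → T c) → ind (b ∧ c) ≡ ind b
ind-∧ false c    _   = refl
ind-∧ true  true _   = refl
ind-∧ true  false b⇒c = ⊥-elim (b⇒c tt)

Σ< : ℕ → (ℕ → ℕ) → ℕ
Σ< zero    f = 0
Σ< (suc a) f = f a + Σ< a f

Σ<-cong : ∀ a {f g : ℕ → ℕ} → (∀ i → f i ≡ g i) → Σ< a f ≡ Σ< a g
Σ<-cong zero    f≗g = refl
Σ<-cong (suc a) f≗g = cong₂ _+_ (f≗g a) (Σ<-cong a f≗g)

sum-filter : ∀ {A : Set} (b : A → Bool) (f : A → ℕ) xs →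
  sum (map f (filter (λ x → Bool._≟_ (b x) true) xs)) ≡ sum (map (λ x → ind (b x) * f x) xs)
sum-filter b f [] = refl
sum-filter b f (x ∷ xs) with b x
... | true  = cong₂ _+_ (sym (+-identityʳ (f x))) (sum-filter b f xs)
... | false = sum-filter b f xs

sum-map-+ : ∀ {A : Set} (f g : A → ℕ) xs →
  sum (map (λ x → f x + g x) xs) ≡ sum (map f xs) + sum (map g xs)
sum-map-+ f g [] = refl
sum-map-+ f g (x ∷ xs) = begin
  f x + g x + sum (map (λ x → f x + g x) xs) ≡⟨ cong (f x + g x +_) (sum-map-+ f g xs) ⟩
  f x + g x + (F + G)                        ≡⟨ interchange (f x) (g x) F G ⟩
  f x + F + (g x + G)                        ∎
  where
  F = sum (map f xs)
  G = sum (map g xs)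
  interchange : ∀ a b c d → a + b + (c + d) ≡ a + c + (b + d)
  interchange = solve-∀

Σw : ℕ → (List Step → ℕ) → ℕ
Σw L f = sum (map f (words L))

Σw-step : ∀ L f → Σw (suc L) f ≡ Σw L (f ∘ (U ∷_)) + Σw L (f ∘ (D ∷_))
Σw-step L f = begin
  sum (map f (map (U ∷_) ws ++ map (D ∷_) ws))
    ≡⟨ cong sum (map-++ f (map (U ∷_) ws) (map (D ∷_) ws)) ⟩
  sum (map f (map (U ∷_) ws) ++ map f (map (D ∷_) ws))
    ≡⟨ sum-++ (map f (map (U ∷_) ws)) _ ⟩
  sum (map f (map (U ∷_) ws)) + sum (map f (map (D ∷_) ws))
    ≡⟨ cong₂ _+_ (cong sum (sym (map-∘ ws))) (cong sum (sym (map-∘ ws))) ⟩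
  Σw L (f ∘ (U ∷_)) + Σw L (f ∘ (D ∷_)) ∎
  where ws = words L

Σw-cong : ∀ L (f g : List Step → ℕ) → (∀ w → length w ≡ L → f w ≡ g w) → Σw L f ≡ Σw L g
Σw-cong zero    f g f≗g = cong (_+ 0) (f≗g [] refl)
Σw-cong (suc L) f g f≗g = begin
  Σw (suc L) f                              ≡⟨ Σw-step L f ⟩
  Σw L (f ∘ (U ∷_)) + Σw L (f ∘ (D ∷_))
    ≡⟨ cong₂ _+_ (Σw-cong L _ _ (λ w ∣w∣ → f≗g (U ∷ w) (cong suc ∣w∣)))
                 (Σw-cong L _ _ (λ w ∣w∣ → f≗g (D ∷ w) (cong suc ∣w∣))) ⟩
  Σw L (g ∘ (U ∷_)) + Σw L (g ∘ (D ∷_))     ≡⟨ Σw-step L g ⟨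
  Σw (suc L) g                              ∎

Σw-vanish : ∀ L (f : List Step → ℕ) → (∀ w → f w ≡ 0) → Σw L f ≡ 0
Σw-vanish zero    f f≡0 = cong (_+ 0) (f≡0 [])
Σw-vanish (suc L) f f≡0 = trans (Σw-step L f)
  (cong₂ _+_ (Σw-vanish L _ (f≡0 ∘ (U ∷_))) (Σw-vanish L _ (f≡0 ∘ (D ∷_))))

module _ (k t : ℕ) where

  paths : ℕ → ℕ → ℕ
  paths L h = Σw L (λ w → ind (stays k t h w))

  downs : ℕ → ℕ → ℕ
  downs L h = Σw L (λ w → ind (stays k t h w) * leadingDowns w)

  -- First-step recursions: from height 0 only an up-step is possible,
  -- from a positive height both steps are.
  paths-floor : ∀ L → paths (suc L) 0 ≡ paths L k
  paths-floor L = trans (Σw-step L _) (trans (cong (paths L k +_) (Σw-vanish L _ (λ _ → refl))) (+-identityʳ _))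

  paths-step : ∀ L h → paths (suc L) (suc h) ≡ paths L (suc h + k) + paths L h
  paths-step L h = Σw-step L _

  -- Words starting with an up-step contribute no leading down-steps, and a
  -- leading down-step from height h+1 contributes 1 plus the leading downs
  -- of the rest, which is admissible from h.
  downs-nil : ∀ h → downs 0 h ≡ 0
  downs-nil h = cong (_+ 0) (*-zeroʳ (ind (h ≡ᵇ t)))

  downs-floor : ∀ L → downs (suc L) 0 ≡ 0
  downs-floor L = trans (Σw-step L _)
    (cong₂ _+_ (Σw-vanish L _ (λ w → *-zeroʳ (ind (stays k t k w)))) (Σw-vanish L _ (λ _ → refl)))

  downs-step : ∀ L h → downs (suc L) (suc h) ≡ paths L h + downs L h
  downs-step L h = begin
    downs (suc L) (suc h)
      ≡⟨ Σw-step L _ ⟩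
    Σw L (λ w → ind (stays k t (suc h + k) w) * 0) + Σw L (λ w → ind (stays k t h w) * suc (leadingDowns w))
      ≡⟨ cong₂ _+_ (Σw-vanish L _ (λ w → *-zeroʳ (ind (stays k t (suc h + k) w))))
                   (Σw-cong L _ _ (λ w _ → *-suc (ind (stays k t h w)) (leadingDowns w))) ⟩
    Σw L (λ w → ind (stays k t h w) + ind (stays k t h w) * leadingDowns w)
      ≡⟨ sum-map-+ _ _ (words L) ⟩
    paths L h + downs L h ∎

  -- Unfolding the leading down-steps of words from height a: the step from
  -- height i+1 to i (for i < a) is taken by exactly the words D^(a-i)·v with
  -- v admissible from i, so it is counted paths (i + c) i times.
  downs-as-paths : ∀ a c → downs (a + c) a ≡ Σ< a (λ i → paths (i + c) i)
  downs-as-paths zero zero    = downs-nil 0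
  downs-as-paths zero (suc c) = downs-floor c
  downs-as-paths (suc a) c    = trans (downs-step (a + c) a) (cong (paths (a + c) a +_) (downs-as-paths a c))

-- Short paths ending at height 0 contain no up-step; this reduces an
-- arbitrary final height t ≤ k to final height 0.
module _ (k : ℕ) where

  paths-too-short : ∀ L h → L < h → paths k 0 L h ≡ 0
  paths-too-short zero    (suc h) _         = refl
  paths-too-short (suc L) (suc h) (s≤s L<h) = trans (paths-step k 0 L h)
    (cong₂ _+_ (paths-too-short L (suc h + k) (≤-trans (m≤n⇒m≤1+n L<h) (m≤m+n (suc h) k)))
               (paths-too-short L h L<h))

  paths-diagonal : ∀ h → paths k 0 h h ≡ 1
  paths-diagonal zero    = refl
  paths-diagonal (suc h) = trans (paths-step k 0 h h)
    (cong₂ _+_ (paths-too-short h (suc h + k) (≤-trans (n<1+n h) (m≤m+n (suc h) k))) (paths-diagonal h))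

  -- A path of length L ≤ k contains no up-step, so it is D^L.
  paths-short : ∀ L → L ≤ k → ∀ h → paths k 0 L h ≡ ind (h ≡ᵇ L)
  paths-short zero    _   h       = +-identityʳ _
  paths-short (suc L) L<k zero    = trans (paths-floor k 0 L) (paths-too-short L k L<k)
  paths-short (suc L) L<k (suc h) = trans (paths-step k 0 L h)
    (cong₂ _+_ (paths-too-short L (suc h + k) (≤-trans L<k (m≤n+m k (suc h))))
               (paths-short L (<⇒≤ L<k) h))

  -- For t ≤ k, ending at height t is the same as ending at 0 after t extra
  -- steps: the recursions agree and so do the initial values.
  paths-target-shift : ∀ t → t ≤ k → ∀ L h → paths k t L h ≡ paths k 0 (L + t) h
  paths-target-shift t t≤k zero    h       = trans (+-identityʳ _) (sym (paths-short t t≤k h))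
  paths-target-shift t t≤k (suc L) zero    = trans (paths-floor k t L)
    (trans (paths-target-shift t t≤k L k) (sym (paths-floor k 0 (L + t))))
  paths-target-shift t t≤k (suc L) (suc h) = trans (paths-step k t L h)
    (trans (cong₂ _+_ (paths-target-shift t t≤k L (suc h + k)) (paths-target-shift t t≤k L h))
           (sym (paths-step k 0 (L + t) h)))

stays-balance : ∀ k t h w → T (stays k t h w) → h + suc k * ups w ≡ t + length w
stays-balance k t h []            h≡t = trans (cong (h +_) (*-zeroʳ (suc k)))
  (trans (+-identityʳ h) (trans (≡ᵇ⇒≡ h t h≡t) (sym (+-identityʳ t))))
stays-balance k t h (U ∷ w)       adm = trans (shift k h (ups w))
  (trans (cong suc (stays-balance k t (h + k) w adm)) (sym (+-suc t (length w))))
  where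
  shift : ∀ k h u → h + suc k * suc u ≡ suc (h + k + suc k * u)
  shift = solve-∀
stays-balance k t (suc h) (D ∷ w) adm =
  trans (cong suc (stays-balance k t h w adm)) (sym (+-suc t (length w)))

-- An admissible word of length (k+1)n from height t has exactly n up-steps,
-- so the up-step condition in isDyck is redundant.
admissible-ups : ∀ k t n w → length w ≡ (k + 1) * n → T (stays k t t w) → ups w ≡ n
admissible-ups k t n w ∣w∣ adm = *-cancelˡ-≡ (ups w) n (suc k) (+-cancelˡ-≡ t _ _
  (trans (stays-balance k t t w adm) (cong (t +_) (trans ∣w∣ (cong (_* n) (+-comm k 1))))))

s0-as-downs : ∀ k t n → s0 k n t ≡ downs k t ((k + 1) * n) t
s0-as-downs k t n = trans (sum-filter (isDyck k t n) leadingDowns (words ((k + 1) * n)))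
  (Σw-cong ((k + 1) * n) _ _ λ w ∣w∣ → cong (_* leadingDowns w)
    (ind-∧ (stays k t t w) (ups w ≡ᵇ n) (λ adm → ≡⇒≡ᵇ (ups w) n (admissible-ups k t n w ∣w∣ adm))))

ballotPaths : ℕ → ℕ → ℕ → ℕ
ballotPaths k n h = paths k 0 (h + suc k * n) h

-- For n ≥ 1 and t ≤ k, s_{n,t,0} = Σ_{h<t} #paths(h → 0 with n up-steps):
-- each leading down-step from height h+1 to h is counted once for every
-- admissible continuation, and ending at t is ending at 0 after t more steps.
s0-as-ballot-sum : ∀ k m t → t ≤ k → s0 k (suc m) t ≡ Σ< t (ballotPaths k (suc m))
s0-as-ballot-sum k m t t≤k = begin
  s0 k n t                                ≡⟨ s0-as-downs k t n ⟩
  downs k t ((k + 1) * n) t               ≡⟨ cong (λ L → downs k t L t) length≡t+c ⟩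
  downs k t (t + c) t                     ≡⟨ downs-as-paths k t t c ⟩
  Σ< t (λ i → paths k t (i + c) i)        ≡⟨ Σ<-cong t shift ⟩
  Σ< t (ballotPaths k n)                  ∎
  where
  n = suc m
  c = suc k * n ∸ t
  c+t : c + t ≡ suc k * n
  c+t = m∸n+n≡m (≤-trans t≤k (≤-trans (n≤1+n k) (m≤m*n (suc k) n)))
  length≡t+c : (k + 1) * n ≡ t + c
  length≡t+c = trans (cong (_* n) (+-comm k 1)) (sym (trans (+-comm t c) c+t))
  shift : ∀ i → paths k t (i + c) i ≡ ballotPaths k n i
  shift i = trans (paths-target-shift k t t≤k (i + c) i)
                  (cong (λ L → paths k 0 L i) (trans (+-assoc i c t) (cong (i +_) c+t)))

-- Ballot theorem for k-Dyck paths in subtraction-free form: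
--   #paths from h to 0 with n up-steps = C(N, n) - k·C(N, n-1),  N = h + (k+1)n.
-- Induction on n and h along the first-step recursion; the right-hand side
-- satisfies the same recursion by Pascal's rule, and the boundary h = 0 is
-- the absorption identity C(M, n+1) = k·C(M, n) for M = k + (k+1)n.
-- The length N is a separate argument so that recursive calls only have to
-- justify the arithmetic of their length index.
ballot : ∀ k n h N → h + suc k * n ≡ N → paths k 0 N h + k * binomBelow N n ≡ N C n
ballot k zero h _ refl = begin
  paths k 0 (h + suc k * 0) h + k * 0 ≡⟨ cong₂ _+_ (cong (λ L → paths k 0 L h) h0≡h) (*-zeroʳ k) ⟩
  paths k 0 h h + 0                   ≡⟨ cong (_+ 0) (paths-diagonal k h) ⟩
  1                                   ∎
  where
  h0≡h : h + suc k * 0 ≡ h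
  h0≡h = trans (cong (h +_) (*-zeroʳ (suc k))) (+-identityʳ h)
ballot k (suc n) zero _ refl = begin
  paths k 0 (suc M) 0 + k * (suc M C n)
    ≡⟨ cong₂ (λ p b → p + k * b) (paths-floor k 0 M) (sym (binomBelow-pascal M n)) ⟩
  paths k 0 M k + k * (binomBelow M n + M C n)
    ≡⟨ regroup (paths k 0 M k) k (binomBelow M n) (M C n) ⟩
  (paths k 0 M k + k * binomBelow M n) + k * (M C n)
    ≡⟨ cong₂ _+_ (ballot k n k M (index k n)) fuss-catalan ⟩
  M C n + M C suc n
    ≡⟨ nCk+nC[k+1]≡[n+1]C[k+1] M n ⟩
  suc M C suc n ∎
  where
  M = n + k * suc n
  regroup : ∀ p k b c → p + k * (b + c) ≡ (p + k * b) + k * c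
  regroup = solve-∀
  index : ∀ k n → k + suc k * n ≡ n + k * suc n
  index = solve-∀
  reassoc : ∀ n k c → suc n * (k * c) ≡ k * suc n * c
  reassoc = solve-∀
  fuss-catalan : k * (M C n) ≡ M C suc n
  fuss-catalan = *-cancelˡ-≡ _ _ (suc n)
    (trans (reassoc n k (M C n)) (sym (absorption n (k * suc n))))
ballot k (suc n) (suc h) _ refl = begin
  paths k 0 (suc L) (suc h) + k * (suc L C n)
    ≡⟨ cong₂ (λ p b → p + k * b) (paths-step k 0 L h) (sym (binomBelow-pascal L n)) ⟩
  (paths k 0 L (suc h + k) + paths k 0 L h) + k * (binomBelow L n + L C n)
    ≡⟨ interchange (paths k 0 L (suc h + k)) (paths k 0 L h) k (binomBelow L n) (L C n) ⟩
  (paths k 0 L (suc h + k) + k * binomBelow L n) + (paths k 0 L h + k * (L C n))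
    ≡⟨ cong₂ _+_ (ballot k n (suc h + k) L (index k n h)) (ballot k (suc n) h L refl) ⟩
  L C n + L C suc n
    ≡⟨ nCk+nC[k+1]≡[n+1]C[k+1] L n ⟩
  suc L C suc n ∎
  where
  L = h + suc k * suc n
  interchange : ∀ p q k b c → (p + q) + k * (b + c) ≡ (p + k * b) + (q + k * c)
  interchange = solve-∀
  index : ∀ k n h → suc h + k + suc k * n ≡ h + suc k * suc n
  index = solve-∀

-- Proof: the ballot theorem expresses the path count through C(N, n) and
-- C(N, n-1), absorption relates these two, and Pascal splits C(N+1, n).
telescope-step : ∀ k m t d → suc t + d ≡ k →
  suc (suc m) * ballotPaths k (suc m) t + d * (suc (t + suc k * suc m) C suc m)
    ≡ suc d * ((t + suc k * suc m) C suc m)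
telescope-step _ m t d refl = +-cancelʳ-≡ Z _ _ (begin
  suc (suc m) * E + d * (suc N C suc m) + Z
    ≡⟨ cong (λ b → suc (suc m) * E + d * b + Z) (sym (nCk+nC[k+1]≡[n+1]C[k+1] N m)) ⟩
  suc (suc m) * E + d * (c₀ + c₁) + Z          ≡⟨ expand m d E k c₀ c₁ ⟩
  suc (suc m) * (E + k * c₀) + d * c₀ + d * c₁  ≡⟨ cong (λ x → suc (suc m) * x + d * c₀ + d * c₁) (ballot k (suc m) t N refl) ⟩
  suc (suc m) * c₁ + d * c₀ + d * c₁            ≡⟨ regroup m d c₀ c₁ ⟩
  suc d * c₁ + (suc m * c₁ + d * c₀)            ≡⟨ cong (λ x → suc d * c₁ + (x + d * c₀)) absorb ⟩
  suc d * c₁ + (e * c₀ + d * c₀)                ≡⟨ cong (suc d * c₁ +_) (collect m t d c₀) ⟩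
  suc d * c₁ + Z                                ∎)
  where
  k = suc t + d
  N = t + suc k * suc m
  E = ballotPaths k (suc m) t
  c₀ = N C m
  c₁ = N C suc m
  e = suc (t + k * suc m)
  Z = suc (suc m) * (k * c₀)
  index : ∀ m t k → m + suc (t + k * suc m) ≡ t + suc k * suc m
  index = solve-∀
  absorb : suc m * c₁ ≡ e * c₀
  absorb = subst (λ X → suc m * (X C suc m) ≡ e * (X C m)) (index m t k) (absorption m e)
  expand : ∀ m d E k c₀ c₁ → suc (suc m) * E + d * (c₀ + c₁) + suc (suc m) * (k * c₀)
                            ≡ suc (suc m) * (E + k * c₀) + d * c₀ + d * c₁
  expand = solve-∀
  regroup : ∀ m d c₀ c₁ → suc (suc m) * c₁ + d * c₀ + d * c₁ ≡ suc d * c₁ + (suc m * c₁ + d * c₀)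
  regroup = solve-∀
  collect : ∀ m t d c₀ → suc (t + (suc t + d) * suc m) * c₀ + d * c₀ ≡ suc (suc m) * ((suc t + d) * c₀)
  collect = solve-∀

telescope : ∀ k m t → t ≤ k →
  suc (suc m) * Σ< t (ballotPaths k (suc m)) + (k ∸ t) * ((t + suc k * suc m) C suc m)
    ≡ k * ((suc k * suc m) C suc m)
telescope k m zero    _   = cong (_+ k * ((suc k * suc m) C suc m)) (*-zeroʳ (suc (suc m)))
telescope k m (suc t) t<k = begin
  n+1 * (E + S) + d * (suc N C n)          ≡⟨ regroup n+1 E S d (suc N C n) ⟩
  n+1 * S + (n+1 * E + d * (suc N C n))    ≡⟨ cong (n+1 * S +_) (telescope-step k m t d (m+[n∸m]≡n t<k)) ⟩
  n+1 * S + suc d * (N C n)                ≡⟨ cong (λ c → n+1 * S + c * (N C n)) (+-∸-assoc 1 t<k) ⟨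
  n+1 * S + (k ∸ t) * (N C n)              ≡⟨ telescope k m t (<⇒≤ t<k) ⟩
  k * ((suc k * n) C n)                    ∎
  where
  n = suc m
  n+1 = suc n
  N = t + suc k * n
  d = k ∸ suc t
  E = ballotPaths k n t
  S = Σ< t (ballotPaths k n)
  regroup : ∀ a e s d c → a * (e + s) + d * c ≡ a * s + (a * e + d * c)
  regroup = solve-∀

open import Data.Integer using (+_)
open import Data.Rational using (_/_) renaming (_-_ to _-ℚ_; _*_ to _*ℚ_)

-- Theorem 5.5.  Steps 1-3 give the identity in ℕ.
theorem5p5 : (k t n : ℕ) → 1 ≤ k → t ≤ k → 1 ≤ n →
    (+ s0 k n t) / 1
      ≡ (((+ k) / suc n) *ℚ ((+ (((k + 1) * n) C n)) / 1))
        -ℚ (((+ (k ∸ t)) / suc n) *ℚ ((+ ((((k + 1) * n) + t) C n)) / 1))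
theorem5p5 k t n@(suc m) _ t≤k (s≤s z≤n) =
  rational-form (s0 k n t) k (((k + 1) * n) C n) (k ∸ t) (((k + 1) * n + t) C n) n identity
  where
  length≡ : (k + 1) * n ≡ suc k * n
  length≡ = cong (_* n) (+-comm k 1)
  identity : suc n * s0 k n t + (k ∸ t) * (((k + 1) * n + t) C n) ≡ k * (((k + 1) * n) C n)
  identity = begin
    suc n * s0 k n t + (k ∸ t) * (((k + 1) * n + t) C n)
      ≡⟨ cong₂ (λ s L → suc n * s + (k ∸ t) * (L C n))
               (s0-as-ballot-sum k m t t≤k) (trans (cong (_+ t) length≡) (+-comm (suc k * n) t)) ⟩
    suc n * Σ< t (ballotPaths k n) + (k ∸ t) * ((t + suc k * n) C n)
      ≡⟨ telescope k m t t≤k ⟩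
    k * ((suc k * n) C n)
      ≡⟨ cong (λ L → k * (L C n)) length≡ ⟨
    k * (((k + 1) * n) C n) ∎
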